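{- Let $G$ be a finite abelian group and let $e_1, \dots, e_k \in G$ be independent elements of odd order, say $\operatorname{ord}(e_i) = n_i \ge 3$. Let $e_0 = a_1 e_1 + \dots + a_k e_k$ with $a_i \in [0, n_i - 1]$, let $G_0 = \{e_0, e_1, \dots, e_k\}$ and $H = \mathcal{B}_{\pm}(G_0)$. If at least two of the $a_i$ are nonzero, then $\min \Delta(H) = 1$.
   Context: Elements $e_1,\dots,e_k$ are independent if $\sum c_i e_i = 0$ with $c_i\in\mathbb{Z}$ implies $c_ie_i=0$ for all $i$; $[a,b]=\{x\in\mathbb{Z}\colon a\le x\le b\}$. For a subset $G_0$ of an abelian group $G$, a sequence over $G_0$ is a finite unordered list $S = g_1\cdots g_\ell$ of elements of $G_0$ (repetitions allowed), forming the free commutative monoid over $G_0$ under concatenation. $S$ is a plus-minus weighted zero-sum sequence if $\sum_i \epsilon_i g_i = 0$ for some $\epsilon_i\in\{+1,-1\}$; $\mathcal{B}_{\pm}(G_0)$ is the monoid of these. For a monoid $H$ with trivial unit group: an atom is a non-identity element not a product of two non-identity elements; $\mathsf{L}_H(a)$ is the set of $k$ such that $a$ is a product of $k$ atoms; for finite $L=\{a_0<\dots<a_k\}$, $\Delta(L)=\{a_i-a_{i-1}\}$; $\Delta(H)=\bigcup_{a\in H}\Delta(\mathsf{L}_H(a))$. -}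

module Defs where

open import Level using (Level; _⊔_)
open import Data.Nat using (ℕ; zero; suc; _<_; _≤_; _+_)
open import Data.Integer using (ℤ; +_; -[1+_])
open import Data.Fin using (Fin)
import Data.Fin as F
open import Data.List using (List; []; _∷_; _++_; length; concat)
open import Data.List.Relation.Unary.All using (All)
open import Data.Bool using (Bool; true; false)
open import Data.Product using (Σ; ∃; ∃-syntax; _×_; _,_)
open import Data.Sum using (_⊎_)
open import Relation.Nullary using (¬_)
open import Relation.Binary.PropositionalEquality using (_≡_; _≢_)
open import Algebra.Bundles using (AbelianGroup)
import Data.List.Relation.Binary.Permutation.Setoid as Perm

module _ {c ℓ : Level} (G : AbelianGroup c ℓ) where
  open AbelianGroup G

  IsFiniteGroup : Set (c ⊔ ℓ)
  IsFiniteGroup = ∃[ m ] Σ (Fin m → Carrier) λ f → ∀ g → ∃[ j ] f j ≈ g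

  natMul : ℕ → Carrier → Carrier
  natMul zero g = ε
  natMul (suc n) g = g ∙ natMul n g

  intMul : ℤ → Carrier → Carrier
  intMul (+ n) g = natMul n g
  intMul -[1+ n ] g = (natMul (suc n) g) ⁻¹

  sumFin : ∀ k → (Fin k → Carrier) → Carrier
  sumFin zero f = ε
  sumFin (suc k) f = f F.zero ∙ sumFin k (λ i → f (F.suc i))

  Independent : ∀ k → (Fin k → Carrier) → Set ℓ
  Independent k e = (coef : Fin k → ℤ) →
    sumFin k (λ i → intMul (coef i) (e i)) ≈ ε → ∀ i → intMul (coef i) (e i) ≈ ε

  HasOrder : Carrier → ℕ → Set ℓ
  HasOrder g n = (1 ≤ n) × (natMul n g ≈ ε) × (∀ m → 1 ≤ m → m < n → ¬ (natMul m g ≈ ε))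

  -- sequences over G (finite unordered lists): lists up to permutation (modulo ≈)
  Seq : Set c
  Seq = List Carrier

  open Perm setoid using (_↭_)

  signedSum : List Bool → Seq → Carrier
  signedSum (true ∷ ss) (g ∷ S) = g ∙ signedSum ss S
  signedSum (false ∷ ss) (g ∷ S) = (g ⁻¹) ∙ signedSum ss S
  signedSum _ _ = ε

  IsPMZeroSum : Seq → Set ℓ
  IsPMZeroSum S = ∃[ ss ] (length ss ≡ length S) × (signedSum ss S ≈ ε)

  module _ {p : Level} (G₀ : Carrier → Set p) where

    InH : Seq → Set (c ⊔ ℓ ⊔ p)
    InH S = All G₀ S × IsPMZeroSum S

    -- identity of H is the empty sequence
    IsAtom : Seq → Set (c ⊔ ℓ ⊔ p)
    IsAtom S = InH S × (S ≢ []) ×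
      ¬ (∃[ T ] ∃[ U ] InH T × InH U × (T ≢ []) × (U ≢ []) × (S ↭ T ++ U))

    InLengthSet : Seq → ℕ → Set (c ⊔ ℓ ⊔ p)
    InLengthSet S n = ∃[ As ] (length As ≡ n) × All IsAtom As × (S ↭ concat As)

    InDeltaL : Seq → ℕ → Set (c ⊔ ℓ ⊔ p)
    InDeltaL S d = ∃[ a ] (1 ≤ d) × InLengthSet S a × InLengthSet S (a + d) ×
      (∀ b → a < b → b < a + d → ¬ InLengthSet S b)

    InDeltaH : ℕ → Set (c ⊔ ℓ ⊔ p)
    InDeltaH d = ∃[ S ] InH S × InDeltaL S d

    MinDeltaH≡ : ℕ → Set (c ⊔ ℓ ⊔ p)
    MinDeltaH≡ m = InDeltaH m × (∀ d → InDeltaH d → m ≤ d)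

-- Let b_l ∈ {a_l, n_l − a_l} be the representative with 2 b_l < n_l (n_l is odd), and call the
-- two coordinates i, j with a_i, a_j ≠ 0 special. Then
--   U = e₀ · ∏_{special} e_l^{n_l − b_l} · ∏_{other} e_l^{b_l},
--   D = e₀² · ∏_{special} e_l^{n_l − 2 b_l} · ∏_{other} e_l^{2 b_l},   W_m = e_m^{n_m}
-- are atoms of H and U² = D · W_i · W_j, so U² has factorisations of lengths 2 and 3.
-- By independence, a sequence over G₀ is a plus-minus zero-sum exactly when its signed counts
-- satisfy one congruence modulo n_l for every l, and the sign freedom turns a_l into b_l.
-- Atomicity is then arithmetic modulo the odd n_l: a part of U or D without e₀ has an even
-- count 2t in every coordinate, and the congruence of the complementary part forces t = 0,
-- or n_l to be even.

module Submission where

open import Defs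
open import Level using (Level)
open import Algebra.Bundles using (AbelianGroup)
open import Data.Nat using (ℕ; zero; suc; _+_; _*_; _∸_; _<_; _≤_; z≤n; s≤s)
open import Data.Nat.Properties
  using ( +-assoc; +-comm; +-identityʳ; +-cancelˡ-≡; +-cancelʳ-≡; +-mono-<; +-monoˡ-<; +-monoʳ-≤; +-cancelˡ-<
        ; m≤m+n; m≤n+m; m<m+n; m<n+m; m+n≡0⇒m≡0; m+n≡0⇒n≡0; m+[n∸m]≡n; m∸n+n≡m; m≤n⇒∃[o]m+o≡n
        ; m<n⇒0<n∸m; n≢0⇒n>0; suc-injective; ≤-pred
        ; ≤-total; ≤-trans; ≤-reflexive; <-≤-trans; ≤-<-trans; <⇒≤; <⇒≱; <-irrefl; <-cmp
        ; +-commutativeSemigroup )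
open import Data.Nat.Divisibility using (_∣_; divides)
open import Data.Nat.DivMod using (_/_; _%_; m≡m%n+[m/n]*n; m%n<n)
open import Data.Nat.Tactic.RingSolver using (solve)
open import Data.Integer using (_⊖_)
open import Data.Integer.Properties using ([1+m]⊖[1+n]≡m⊖n)
open import Data.Fin using (Fin; zero; suc; _≟_)
open import Data.Bool using (Bool; true; false; if_then_else_; _∨_)
open import Data.List using (List; []; _∷_; _++_; map; replicate; length; concat)
import Data.List.Properties as List
open import Data.List.Relation.Unary.All as All using (All)
import Data.List.Relation.Unary.All.Properties as All
import Data.List.Relation.Binary.Permutation.Propositional as ↭
import Data.List.Relation.Binary.Permutation.Propositional.Properties as ↭
import Data.List.Relation.Binary.Permutation.Setoid as Setoid-↭
open import Data.List.Relation.Binary.Pointwise using (Pointwise)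
open import Data.Product using (Σ; ∃-syntax; _×_; _,_; proj₁; proj₂)
open import Data.Sum using (_⊎_; inj₁; inj₂; [_,_]′)
open import Data.Empty using (⊥; ⊥-elim)
open import Relation.Nullary using (¬_; does; yes; no)
open import Relation.Binary.Definitions using (tri<; tri≈; tri>)
open import Relation.Binary.PropositionalEquality as ≡ using (_≡_; _≢_)
import Algebra.Properties.CommutativeSemigroup +-commutativeSemigroup as ℕ-Comm

-- Congruences modulo n

module _ where
  open ≡ using (refl; sym; trans; cong; subst; subst₂)
  open ≡.≡-Reasoning

  infix 4 _≡_mod_

  _≡_mod_ : ℕ → ℕ → ℕ → Set
  x ≡ y mod n = ∃[ q ] (x + q * n ≡ y ⊎ y + q * n ≡ x)

  ≡-mod-reflexive : ∀ {n x y} → x ≡ y → x ≡ y mod n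
  ≡-mod-reflexive {x = x} x≡y = 0 , inj₁ (trans (+-identityʳ x) x≡y)

  ≡-mod-sym : ∀ {n x y} → x ≡ y mod n → y ≡ x mod n
  ≡-mod-sym (q , inj₁ eq) = q , inj₂ eq
  ≡-mod-sym (q , inj₂ eq) = q , inj₁ eq

  ≡-mod-+ʳ : ∀ {n x y} z → x ≡ y mod n → x + z ≡ y + z mod n
  ≡-mod-+ʳ {n} {x} z (q , inj₁ refl) = q , inj₁ (solve (x ∷ z ∷ q ∷ n ∷ []))
  ≡-mod-+ʳ {n} {y = y} z (q , inj₂ refl) = q , inj₂ (solve (y ∷ z ∷ q ∷ n ∷ []))

  ≡-mod-cancelˡ : ∀ {n x y} z → z + x ≡ z + y mod n → x ≡ y mod n
  ≡-mod-cancelˡ {n} {x} z (q , inj₁ eq) = q , inj₁ (+-cancelˡ-≡ z _ _ (trans (sym (+-assoc z x (q * n))) eq))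
  ≡-mod-cancelˡ {n} {y = y} z (q , inj₂ eq) = q , inj₂ (+-cancelˡ-≡ z _ _ (trans (sym (+-assoc z y (q * n))) eq))

  ≡-mod-dropʳ : ∀ {n x y} c → x + c * n ≡ y mod n → x ≡ y mod n
  ≡-mod-dropʳ {n} {x} c (q , inj₁ refl) = c + q , inj₁ (solve (x ∷ c ∷ q ∷ n ∷ []))
  ≡-mod-dropʳ {n} {x} {y} c (q , inj₂ eq) with ≤-total c q
  ... | inj₁ c≤q with d , refl ← m≤n⇒∃[o]m+o≡n c≤q =
    d , inj₂ (+-cancelʳ-≡ (c * n) _ _ (begin
      y + d * n + c * n  ≡⟨ solve (y ∷ c ∷ d ∷ n ∷ []) ⟩
      y + (c + d) * n    ≡⟨ eq ⟩
      x + c * n          ∎))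
  ... | inj₂ q≤c with d , refl ← m≤n⇒∃[o]m+o≡n q≤c =
    d , inj₁ (+-cancelʳ-≡ (q * n) _ _ (begin
      x + d * n + q * n  ≡⟨ solve (x ∷ q ∷ d ∷ n ∷ []) ⟩
      x + (q + d) * n    ≡⟨ eq ⟨
      y + q * n          ∎))

  ≡-mod-drop : ∀ {n x y} c d → x + c * n ≡ y + d * n mod n → x ≡ y mod n
  ≡-mod-drop c d eq = ≡-mod-dropʳ c (≡-mod-sym (≡-mod-dropʳ d (≡-mod-sym eq)))

  ≡-mod-complement : ∀ {n a b} P M p q → a + b ≡ n →
    P * a + p ≡ M * a + q mod n → P * b + q ≡ M * b + p mod n
  ≡-mod-complement {a = a} {b} P M p q refl eq =
    ≡-mod-sym (≡-mod-drop P M (subst₂ (λ u v → u ≡ v mod a + b) lhs rhs (≡-mod-+ʳ (P * b + M * b) eq)))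
    where
    lhs : P * a + p + (P * b + M * b) ≡ M * b + p + P * (a + b)
    lhs = solve (P ∷ M ∷ a ∷ b ∷ p ∷ [])
    rhs : M * a + q + (P * b + M * b) ≡ P * b + q + M * (a + b)
    rhs = solve (P ∷ M ∷ a ∷ b ∷ q ∷ [])

  ≡-mod-below : ∀ {n x y} → x ≡ y mod n → x < n + n → y < n → y ≡ x ⊎ x ≡ y + n
  ≡-mod-below (zero , inj₁ refl) _ _ = inj₁ (+-identityʳ _)
  ≡-mod-below (zero , inj₂ refl) _ _ = inj₁ (sym (+-identityʳ _))
  ≡-mod-below {n} {x} (suc q , inj₁ refl) _ y<n = ⊥-elim (<⇒≱ y<n (≤-trans (m≤m+n n (q * n)) (m≤n+m _ x)))
  ≡-mod-below {n} {y = y} (suc zero , inj₂ refl) _ _ = inj₂ (cong (y +_) (+-identityʳ n))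
  ≡-mod-below {n} {y = y} (suc (suc q) , inj₂ refl) x<2n _ =
    ⊥-elim (<⇒≱ x<2n (≤-trans (+-monoʳ-≤ n (m≤m+n n (q * n))) (m≤n+m _ y)))

  ≡-mod⇒≡ : ∀ {n x y} → x ≡ y mod n → x < n → y < n → x ≡ y
  ≡-mod⇒≡ {n} {x} {y} eq x<n y<n with ≡-mod-below eq (<-≤-trans x<n (m≤m+n n n)) y<n
  ... | inj₁ y≡x = sym y≡x
  ... | inj₂ refl = ⊥-elim (<⇒≱ x<n (m≤n+m n y))

  ≡-mod⇒≡-sum : ∀ {n x y} → x ≡ y mod n → x + y < n → x ≡ y
  ≡-mod⇒≡-sum {x = x} {y} eq x+y<n =
    ≡-mod⇒≡ eq (≤-<-trans (m≤m+n x y) x+y<n) (≤-<-trans (m≤n+m y x) x+y<n)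

  ¬2∣⇒≢double : ∀ {n} → ¬ 2 ∣ n → ∀ m → n ≢ m + m
  ¬2∣⇒≢double odd m refl = odd (divides m (solve (m ∷ [])))

  double-complement : ∀ {n u d b} → u + b ≡ n → d + (b + b) ≡ n → u + u ≡ d + n
  double-complement {u = u} {d} {b} refl eq = +-cancelʳ-≡ (b + b) _ _ (begin
    u + u + (b + b)         ≡⟨ solve (u ∷ b ∷ []) ⟩
    (u + b) + (u + b)       ≡⟨ cong (_+ (u + b)) eq ⟨
    d + (b + b) + (u + b)   ≡⟨ solve (u ∷ d ∷ b ∷ []) ⟩
    d + (u + b) + (b + b)   ∎)

  half-representative : ∀ {n a} → ¬ 2 ∣ n → a < n →
    ∃[ b ] (b + b < n) × (a ≡ b ⊎ a + b ≡ n) × (a ≢ 0 → 0 < b)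
  half-representative {n} {a} odd a<n with <-cmp (a + a) n
  ... | tri< 2a<n _ _ = a , 2a<n , inj₁ refl , n≢0⇒n>0
  ... | tri≈ _ 2a≡n _ = ⊥-elim (¬2∣⇒≢double odd a (sym 2a≡n))
  ... | tri> _ _ n<2a = n ∸ a , subst (n ∸ a + (n ∸ a) <_) a+b≡n (+-monoˡ-< (n ∸ a) b<a) ,
                         inj₂ a+b≡n , λ _ → m<n⇒0<n∸m a<n
    where
    a+b≡n : a + (n ∸ a) ≡ n
    a+b≡n = m+[n∸m]≡n (<⇒≤ a<n)
    b<a : n ∸ a < a
    b<a = +-cancelˡ-< a (n ∸ a) a (subst (_< a + a) (sym a+b≡n) n<2a)

  private
    ≤-by : ∀ {u s t} v → t ≡ s → u + v ≡ t → u ≤ s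
    ≤-by v refl refl = m≤m+n _ v

    t+t≡0 : ∀ t u → t + t + u ≡ 0 → t ≡ 0
    t+t≡0 t u eq = m+n≡0⇒m≡0 t (m+n≡0⇒m≡0 (t + t) eq)

  shifted-short : ∀ {n B x y} t → ¬ 2 ∣ n → B < n → B + x ≡ y mod n → t + t + (x + y) ≡ B → t ≡ 0
  shifted-short {n} {B} {x} {y} t odd B<n eq sum with ≡-mod-below eq (+-mono-< B<n x<n) y<n
    where
    x≤B : x ≤ B
    x≤B = ≤-by (y + (t + t)) sum (solve (t ∷ x ∷ y ∷ []))
    y≤B : y ≤ B
    y≤B = ≤-by (x + (t + t)) sum (solve (t ∷ x ∷ y ∷ []))
    x<n : x < n
    x<n = ≤-<-trans x≤B B<n
    y<n : y < n
    y<n = ≤-<-trans y≤B B<n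
  ... | inj₁ refl = t+t≡0 t (x + x) (+-cancelˡ-≡ B _ 0 (begin
        B + (t + t + (x + x))   ≡⟨ solve (B ∷ t ∷ x ∷ []) ⟩
        t + t + (x + (B + x))   ≡⟨ sum ⟩
        B                       ≡⟨ +-identityʳ B ⟨
        B + 0                   ∎))
  ... | inj₂ B+x≡y+n = ⊥-elim (¬2∣⇒≢double odd (t + x) (+-cancelˡ-≡ y _ _ (begin
        y + n                   ≡⟨ B+x≡y+n ⟨
        B + x                   ≡⟨ cong (_+ x) sum ⟨
        t + t + (x + y) + x     ≡⟨ solve (t ∷ x ∷ y ∷ []) ⟩
        y + (t + x + (t + x))   ∎)))

  shifted-long : ∀ {n B x y} t → ¬ 2 ∣ n → 0 < B → B + x ≡ y mod n → t + t + (x + y) + B ≡ n → t ≡ 0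
  shifted-long {n} {B} {x} {y} t odd 0<B eq sum with ≡-mod-below eq (≤-<-trans B+x≤n (m<m+n n 0<n)) y<n
    where
    B+x≤n : B + x ≤ n
    B+x≤n = ≤-by (t + t + y) sum (solve (t ∷ x ∷ y ∷ B ∷ []))
    B≤n : B ≤ n
    B≤n = ≤-by (t + t + (x + y)) sum (solve (t ∷ x ∷ y ∷ B ∷ []))
    y+B≤n : y + B ≤ n
    y+B≤n = ≤-by (t + t + x) sum (solve (t ∷ x ∷ y ∷ B ∷ []))
    0<n : 0 < n
    0<n = <-≤-trans 0<B B≤n
    y<n : y < n
    y<n = <-≤-trans (m<m+n y 0<B) y+B≤n
  ... | inj₁ refl = ⊥-elim (¬2∣⇒≢double odd (t + x + B) (begin
        n                             ≡⟨ sum ⟨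
        t + t + (x + (B + x)) + B     ≡⟨ solve (t ∷ x ∷ B ∷ []) ⟩
        t + x + B + (t + x + B)       ∎))
  ... | inj₂ B+x≡y+n = t+t≡0 t (y + y) (+-cancelˡ-≡ (B + x) _ 0 (begin
        B + x + (t + t + (y + y))     ≡⟨ solve (t ∷ x ∷ y ∷ B ∷ []) ⟩
        y + (t + t + (x + y) + B)     ≡⟨ cong (y +_) sum ⟩
        y + n                         ≡⟨ B+x≡y+n ⟨
        B + x                         ≡⟨ +-identityʳ (B + x) ⟨
        B + x + 0                     ∎))

  opposite-signs : ∀ {n B x y} t → ¬ 2 ∣ n → 0 < B → x ≡ y mod n → t + t + (x + y) + (B + B) ≡ n → ⊥
  opposite-signs {n} {B} {x} {y} t odd 0<B eq sum with ≡-mod⇒≡-sum eq x+y<n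
    where
    x+y<n : x + y < n
    x+y<n = <-≤-trans (m<m+n (x + y) (+-mono-< 0<B 0<B)) (≤-by (t + t) sum (solve (t ∷ x ∷ y ∷ B ∷ [])))
  ... | refl = ¬2∣⇒≢double odd (t + x + B) (begin
        n                               ≡⟨ sum ⟨
        t + t + (x + x) + (B + B)       ≡⟨ solve (t ∷ x ∷ B ∷ []) ⟩
        t + x + B + (t + x + B)         ∎)

  two-shifted : ∀ {n B x₁ y₁ x₂ y₂} → ¬ 2 ∣ n → 0 < B → B + x₁ ≡ y₁ mod n → B + x₂ ≡ y₂ mod n →
    x₁ + y₁ + (x₂ + y₂) + (B + B) ≡ n → ⊥
  two-shifted {n} {B} {x₁} {y₁} {x₂} {y₂} odd 0<B eq₁ eq₂ sum
    with ≡-mod⇒≡ eq₁ (<-≤-trans (m<m+n (B + x₁) 0<B) B+x₁+B≤n) (<-≤-trans (m<m+n y₁ 0<B) y₁+B≤n)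
       | ≡-mod⇒≡ eq₂ (<-≤-trans (m<m+n (B + x₂) 0<B) B+x₂+B≤n) (<-≤-trans (m<m+n y₂ 0<B) y₂+B≤n)
    where
    B+x₁+B≤n : B + x₁ + B ≤ n
    B+x₁+B≤n = ≤-by (y₁ + (x₂ + y₂)) sum (solve (B ∷ x₁ ∷ y₁ ∷ x₂ ∷ y₂ ∷ []))
    y₁+B≤n : y₁ + B ≤ n
    y₁+B≤n = ≤-by (x₁ + (x₂ + y₂) + B) sum (solve (B ∷ x₁ ∷ y₁ ∷ x₂ ∷ y₂ ∷ []))
    B+x₂+B≤n : B + x₂ + B ≤ n
    B+x₂+B≤n = ≤-by (x₁ + y₁ + y₂) sum (solve (B ∷ x₁ ∷ y₁ ∷ x₂ ∷ y₂ ∷ []))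
    y₂+B≤n : y₂ + B ≤ n
    y₂+B≤n = ≤-by (x₁ + y₁ + x₂ + B) sum (solve (B ∷ x₁ ∷ y₁ ∷ x₂ ∷ y₂ ∷ []))
  ... | refl | refl = ¬2∣⇒≢double odd (x₁ + x₂ + B + B) (begin
        n                                             ≡⟨ sum ⟨
        x₁ + (B + x₁) + (x₂ + (B + x₂)) + (B + B)     ≡⟨ solve (B ∷ x₁ ∷ x₂ ∷ []) ⟩
        x₁ + x₂ + B + B + (x₁ + x₂ + B + B)           ∎)

  two-balanced : ∀ {n x₁ y₁ x₂ y₂} → ¬ 2 ∣ n → x₁ ≡ y₁ mod n → x₂ ≡ y₂ mod n →
    0 < x₁ + y₁ → 0 < x₂ + y₂ → x₁ + y₁ + (x₂ + y₂) ≡ n → ⊥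
  two-balanced {n} {x₁} {y₁} {x₂} {y₂} odd eq₁ eq₂ 0<s₁ 0<s₂ sum
    with ≡-mod⇒≡-sum eq₁ (<-≤-trans (m<m+n (x₁ + y₁) 0<s₂) (≤-reflexive sum))
       | ≡-mod⇒≡-sum eq₂ (<-≤-trans (m<n+m (x₂ + y₂) 0<s₁) (≤-reflexive sum))
  ... | refl | refl = ¬2∣⇒≢double odd (x₁ + x₂) (begin
        n                          ≡⟨ sum ⟨
        x₁ + x₁ + (x₂ + x₂)        ≡⟨ solve (x₁ ∷ x₂ ∷ []) ⟩
        x₁ + x₂ + (x₁ + x₂)        ∎)

  +≡1 : ∀ u v → u + v ≡ 1 → (u ≡ 0 × v ≡ 1) ⊎ (u ≡ 1 × v ≡ 0)
  +≡1 zero (suc zero) _ = inj₁ (refl , refl)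
  +≡1 (suc zero) zero _ = inj₂ (refl , refl)
  +≡1 zero zero ()
  +≡1 zero (suc (suc _)) ()
  +≡1 (suc zero) (suc _) ()
  +≡1 (suc (suc _)) _ ()

  +≡2 : ∀ u v → u + v ≡ 2 → (u ≡ 0 × v ≡ 2) ⊎ (u ≡ 1 × v ≡ 1) ⊎ (u ≡ 2 × v ≡ 0)
  +≡2 zero (suc (suc zero)) _ = inj₁ (refl , refl)
  +≡2 (suc zero) (suc zero) _ = inj₂ (inj₁ (refl , refl))
  +≡2 (suc (suc zero)) zero _ = inj₂ (inj₂ (refl , refl))
  +≡2 zero zero ()
  +≡2 zero (suc zero) ()
  +≡2 zero (suc (suc (suc _))) ()
  +≡2 (suc zero) zero ()
  +≡2 (suc zero) (suc (suc _)) ()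
  +≡2 (suc (suc zero)) (suc _) ()
  +≡2 (suc (suc (suc _))) _ ()

-- Multiples and finite sums in an abelian group

δ : ∀ {k} → Fin k → Fin k → ℕ
δ m i = if does (m ≟ i) then 1 else 0

δ-refl : ∀ {k} (m : Fin k) → δ m m ≡ 1
δ-refl m with m ≟ m
... | yes _ = ≡.refl
... | no m≢m = ⊥-elim (m≢m ≡.refl)

δ-≢ : ∀ {k} {m i : Fin k} → m ≢ i → δ m i ≡ 0
δ-≢ {m = m} {i} m≢i with m ≟ i
... | yes m≡i = ⊥-elim (m≢i m≡i)
... | no _ = ≡.refl

δ≤1 : ∀ {k} (m i : Fin k) → δ m i ≤ 1
δ≤1 m i with m ≟ i
... | yes _ = s≤s z≤n
... | no _ = z≤n

δ≢0⇒≡ : ∀ {k} (m i : Fin k) → δ m i ≢ 0 → m ≡ i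
δ≢0⇒≡ m i δ≢0 with m ≟ i
... | yes m≡i = m≡i
... | no _ = ⊥-elim (δ≢0 ≡.refl)

module _ {c ℓ : Level} (G : AbelianGroup c ℓ) where

  open AbelianGroup G
  open import Algebra.Properties.AbelianGroup G
    using (ε⁻¹≈ε; ⁻¹-∙-comm; x∙y⁻¹≈ε⇒x≈y; x≈y⇒x∙y⁻¹≈ε; ∙-cancelˡ)
  open import Algebra.Properties.CommutativeSemigroup commutativeSemigroup using (interchange)
  open import Algebra.Properties.Monoid.Mult monoid
    using (×-congʳ; ×-homo-+; ×-assocˡ) renaming (_×_ to _·_)
  open import Algebra.Properties.CommutativeMonoid.Sum commutativeMonoid
    using (sum; ∑-distrib-+; sum-cong-≋; sum-replicate-zero)
  open import Relation.Binary.Reasoning.Setoid setoid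

  natMul≡· : ∀ m g → natMul G m g ≡ m · g
  natMul≡· zero g = ≡.refl
  natMul≡· (suc m) g = ≡.cong (g ∙_) (natMul≡· m g)

  sumFin≡sum : ∀ k f → sumFin G k f ≡ sum f
  sumFin≡sum zero f = ≡.refl
  sumFin≡sum (suc k) f = ≡.cong (f zero ∙_) (sumFin≡sum k (λ i → f (suc i)))

  ·-ε : ∀ m → m · ε ≈ ε
  ·-ε zero = refl
  ·-ε (suc m) = trans (identityˡ _) (·-ε m)

  ·-multiple : ∀ g n q → n · g ≈ ε → (q * n) · g ≈ ε
  ·-multiple g n q n·g≈ε = begin
    (q * n) · g   ≈⟨ ×-assocˡ g q n ⟨
    q · (n · g)   ≈⟨ ×-congʳ q n·g≈ε ⟩
    q · ε         ≈⟨ ·-ε q ⟩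
    ε             ∎

  ·-absorbs : ∀ g n x q → n · g ≈ ε → (x + q * n) · g ≈ x · g
  ·-absorbs g n x q n·g≈ε = begin
    (x + q * n) · g      ≈⟨ ×-homo-+ g x (q * n) ⟩
    x · g ∙ (q * n) · g  ≈⟨ ∙-congˡ (·-multiple g n q n·g≈ε) ⟩
    x · g ∙ ε            ≈⟨ identityʳ _ ⟩
    x · g                ∎

  order-∣ : ∀ {n} g d → HasOrder G g n → d · g ≈ ε → n ∣ d
  order-∣ {suc n′} g d (_ , n·g≈ε , minimal) d·g≈ε = remainder-zero (d % n) ≡.refl (m%n<n d n)
    where
    n q : ℕ
    n = suc n′
    q = d / n
    remainder-zero : ∀ r → d % n ≡ r → r < n → n ∣ d
    remainder-zero zero r≡0 _ =
      divides q (≡.trans (m≡m%n+[m/n]*n d n) (≡.cong (_+ q * n) r≡0))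
    remainder-zero (suc r) r≡ r<n = ⊥-elim (minimal (suc r) (s≤s z≤n) r<n (begin
      natMul G (suc r) g         ≡⟨ natMul≡· (suc r) g ⟩
      suc r · g                  ≈⟨ ·-absorbs g n (suc r) q (≡.subst (_≈ ε) (natMul≡· n g) n·g≈ε) ⟨
      (suc r + q * n) · g        ≡⟨ ≡.cong (_· g) (≡.trans (≡.cong (_+ q * n) (≡.sym r≡)) (≡.sym (m≡m%n+[m/n]*n d n))) ⟩
      d · g                      ≈⟨ d·g≈ε ⟩
      ε                          ∎))

  ·-difference : ∀ g x d → x · g ≈ (x + d) · g → d · g ≈ ε
  ·-difference g x d eq = ∙-cancelˡ (x · g) _ _ (begin
    x · g ∙ d · g   ≈⟨ ×-homo-+ g x d ⟨
    (x + d) · g     ≈⟨ eq ⟨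
    x · g           ≈⟨ identityʳ _ ⟨
    x · g ∙ ε       ∎)

  ·≈·⇒≡-mod : ∀ {n} g x y → HasOrder G g n → x · g ≈ y · g → x ≡ y mod n
  ·≈·⇒≡-mod g x y ho eq with ≤-total x y
  ... | inj₁ x≤y with d , ≡.refl ← m≤n⇒∃[o]m+o≡n x≤y
                 with divides q ≡.refl ← order-∣ g d ho (·-difference g x d eq) = q , inj₁ ≡.refl
  ... | inj₂ y≤x with d , ≡.refl ← m≤n⇒∃[o]m+o≡n y≤x
                 with divides q ≡.refl ← order-∣ g d ho (·-difference g y d (sym eq)) = q , inj₂ ≡.refl

  ≡-mod⇒·≈· : ∀ {n} g x y → HasOrder G g n → x ≡ y mod n → x · g ≈ y · g
  ≡-mod⇒·≈· {n} g x y (_ , n·g≈ε , _) (q , inj₁ ≡.refl) =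
    sym (·-absorbs g n x q (≡.subst (_≈ ε) (natMul≡· n g) n·g≈ε))
  ≡-mod⇒·≈· {n} g x y (_ , n·g≈ε , _) (q , inj₂ ≡.refl) =
    ·-absorbs g n y q (≡.subst (_≈ ε) (natMul≡· n g) n·g≈ε)

  ∑-⁻¹ : ∀ {k} (f : Fin k → Carrier) → sum (λ i → f i ⁻¹) ≈ sum f ⁻¹
  ∑-⁻¹ {zero} f = sym ε⁻¹≈ε
  ∑-⁻¹ {suc k} f = trans (∙-congˡ (∑-⁻¹ (λ i → f (suc i)))) (⁻¹-∙-comm _ _)

  ∑-δ : ∀ {k} (m : Fin k) (f : Fin k → Carrier) → sum (λ i → δ m i · f i) ≈ f m
  ∑-δ {suc k} zero f = trans (∙-cong (identityʳ _) (sum-replicate-zero k)) (identityʳ _)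
  ∑-δ {suc k} (suc m) f = trans (identityˡ _) (∑-δ m (λ i → f (suc i)))

  private
    ∙-cancel-common : ∀ g u v → (g ∙ u) ∙ (g ∙ v) ⁻¹ ≈ u ∙ v ⁻¹
    ∙-cancel-common g u v = begin
      (g ∙ u) ∙ (g ∙ v) ⁻¹       ≈⟨ ∙-congˡ (⁻¹-∙-comm g v) ⟨
      (g ∙ u) ∙ (g ⁻¹ ∙ v ⁻¹)    ≈⟨ interchange g u (g ⁻¹) (v ⁻¹) ⟩
      (g ∙ g ⁻¹) ∙ (u ∙ v ⁻¹)    ≈⟨ ∙-congʳ (inverseʳ g) ⟩
      ε ∙ (u ∙ v ⁻¹)             ≈⟨ identityˡ _ ⟩
      u ∙ v ⁻¹                   ∎

  intMul-⊖ : ∀ x y g → intMul G (x ⊖ y) g ≈ x · g ∙ (y · g) ⁻¹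
  intMul-⊖ x zero g = begin
    natMul G x g       ≡⟨ natMul≡· x g ⟩
    x · g              ≈⟨ identityʳ _ ⟨
    x · g ∙ ε          ≈⟨ ∙-congˡ ε⁻¹≈ε ⟨
    x · g ∙ ε ⁻¹       ∎
  intMul-⊖ zero (suc y) g = trans (⁻¹-cong (reflexive (natMul≡· (suc y) g))) (sym (identityˡ _))
  intMul-⊖ (suc x) (suc y) g = begin
    intMul G (suc x ⊖ suc y) g       ≡⟨ ≡.cong (λ z → intMul G z g) ([1+m]⊖[1+n]≡m⊖n x y) ⟩
    intMul G (x ⊖ y) g               ≈⟨ intMul-⊖ x y g ⟩
    x · g ∙ (y · g) ⁻¹               ≈⟨ ∙-cancel-common g _ _ ⟨
    suc x · g ∙ (suc y · g) ⁻¹       ∎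

  independent⇒·≈· : ∀ {k e} → Independent G k e → (P M : Fin k → ℕ) →
    sum (λ i → P i · e i) ≈ sum (λ i → M i · e i) → ∀ i → P i · e i ≈ M i · e i
  independent⇒·≈· {k} {e} indep P M eq i = x∙y⁻¹≈ε⇒x≈y _ _ (begin
    P i · e i ∙ (M i · e i) ⁻¹         ≈⟨ intMul-⊖ (P i) (M i) (e i) ⟨
    intMul G (P i ⊖ M i) (e i)         ≈⟨ indep (λ j → P j ⊖ M j) difference≈ε i ⟩
    ε                                  ∎)
    where
    difference≈ε : sumFin G k (λ j → intMul G (P j ⊖ M j) (e j)) ≈ ε
    difference≈ε = begin
      sumFin G k (λ j → intMul G (P j ⊖ M j) (e j))            ≡⟨ sumFin≡sum k _ ⟩
      sum (λ j → intMul G (P j ⊖ M j) (e j))                   ≈⟨ sum-cong-≋ (λ j → intMul-⊖ (P j) (M j) (e j)) ⟩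
      sum (λ j → P j · e j ∙ (M j · e j) ⁻¹)                   ≈⟨ ∑-distrib-+ (λ j → P j · e j) (λ j → (M j · e j) ⁻¹) ⟩
      sum (λ j → P j · e j) ∙ sum (λ j → (M j · e j) ⁻¹)       ≈⟨ ∙-congˡ (∑-⁻¹ (λ j → M j · e j)) ⟩
      sum (λ j → P j · e j) ∙ sum (λ j → M j · e j) ⁻¹         ≈⟨ x≈y⇒x∙y⁻¹≈ε eq ⟩
      ε                                                        ∎

  signedSum-++ : ∀ ss ss′ {T} V → length ss ≡ length T →
    signedSum G (ss ++ ss′) (T ++ V) ≈ signedSum G ss T ∙ signedSum G ss′ V
  signedSum-++ [] ss′ {[]} V _ = sym (identityˡ _)
  signedSum-++ (true ∷ ss) ss′ {g ∷ T} V eq =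
    trans (∙-congˡ (signedSum-++ ss ss′ V (suc-injective eq))) (sym (assoc _ _ _))
  signedSum-++ (false ∷ ss) ss′ {g ∷ T} V eq =
    trans (∙-congˡ (signedSum-++ ss ss′ V (suc-injective eq))) (sym (assoc _ _ _))

  InH-++ : ∀ {p} {G₀ : Carrier → Set p} {T V} → InH G G₀ T → InH G G₀ V → InH G G₀ (T ++ V)
  InH-++ {T = T} {V} (allT , ss , lenT , sumT) (allV , ss′ , lenV , sumV) =
    All.++⁺ allT allV ,
    ss ++ ss′ ,
    ≡.trans (List.length-++ ss) (≡.trans (≡.cong₂ _+_ lenT lenV) (≡.sym (List.length-++ T))) ,
    trans (signedSum-++ ss ss′ V lenT) (trans (∙-cong sumT sumV) (identityˡ ε))

-- Multisets over a finite index set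

module _ where
  open import Data.List.Relation.Binary.Permutation.Propositional
    using (_↭_; refl; prep; swap; trans; module PermutationReasoning)
  open import Data.List.Relation.Binary.Permutation.Propositional.Properties using (++⁺ˡ; shifts; map⁺)
  open ≡ using (cong; cong₂)

  count : ∀ {K} → Fin K → List (Fin K) → ℕ
  count x [] = 0
  count x (y ∷ ys) = δ y x + count x ys

  count-++ : ∀ {K} (x : Fin K) xs ys → count x (xs ++ ys) ≡ count x xs + count x ys
  count-++ x [] ys = ≡.refl
  count-++ x (y ∷ xs) ys = ≡.trans (cong (δ y x +_) (count-++ x xs ys)) (≡.sym (+-assoc (δ y x) _ _))

  count-↭ : ∀ {K} (x : Fin K) {xs ys : List (Fin K)} → xs ↭ ys → count x xs ≡ count x ys
  count-↭ x refl = ≡.refl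
  count-↭ x (prep y p) = cong (δ y x +_) (count-↭ x p)
  count-↭ x (swap y z p) = ≡.trans (cong (λ c → δ y x + (δ z x + c)) (count-↭ x p)) (ℕ-Comm.x∙yz≈y∙xz (δ y x) (δ z x) _)
  count-↭ x (trans p q) = ≡.trans (count-↭ x p) (count-↭ x q)

  block : ∀ {K} → (Fin K → ℕ) → List (Fin K)
  block {zero} c = []
  block {suc K} c = replicate (c zero) zero ++ map suc (block (λ x → c (suc x)))

  private
    count-zero-replicate : ∀ {K} m → count {suc K} zero (replicate m zero) ≡ m
    count-zero-replicate zero = ≡.refl
    count-zero-replicate (suc m) = cong suc (count-zero-replicate m)

    count-suc-replicate : ∀ {K} m (x : Fin K) → count (suc x) (replicate m zero) ≡ 0
    count-suc-replicate zero x = ≡.refl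
    count-suc-replicate (suc m) x = count-suc-replicate m x

    count-zero-map-suc : ∀ {K} (xs : List (Fin K)) → count zero (map suc xs) ≡ 0
    count-zero-map-suc [] = ≡.refl
    count-zero-map-suc (x ∷ xs) = count-zero-map-suc xs

    count-suc-map-suc : ∀ {K} (x : Fin K) xs → count (suc x) (map suc xs) ≡ count x xs
    count-suc-map-suc x [] = ≡.refl
    count-suc-map-suc x (y ∷ xs) = cong (δ y x +_) (count-suc-map-suc x xs)

    replicate-+ : ∀ {A : Set} m n (x : A) → replicate (m + n) x ≡ replicate m x ++ replicate n x
    replicate-+ zero n x = ≡.refl
    replicate-+ (suc m) n x = cong (x ∷_) (replicate-+ m n x)

  count-block : ∀ {K} (c : Fin K → ℕ) x → count x (block c) ≡ c x
  count-block {suc K} c zero = begin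
    count zero (R ++ map suc rest)             ≡⟨ count-++ zero R _ ⟩
    count zero R + count zero (map suc rest)   ≡⟨ cong₂ _+_ (count-zero-replicate (c zero)) (count-zero-map-suc rest) ⟩
    c zero + 0                                 ≡⟨ +-identityʳ (c zero) ⟩
    c zero                                     ∎
    where open ≡.≡-Reasoning
          R : List (Fin (suc K))
          R = replicate (c zero) zero
          rest : List (Fin K)
          rest = block (λ y → c (suc y))
  count-block {suc K} c (suc x) = begin
    count (suc x) (R ++ map suc rest)                ≡⟨ count-++ (suc x) R _ ⟩
    count (suc x) R + count (suc x) (map suc rest)   ≡⟨ cong₂ _+_ (count-suc-replicate (c zero) x) (count-suc-map-suc x rest) ⟩
    count x rest                                     ≡⟨ count-block (λ y → c (suc y)) x ⟩
    c (suc x)                                        ∎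
    where open ≡.≡-Reasoning
          R : List (Fin (suc K))
          R = replicate (c zero) zero
          rest : List (Fin K)
          rest = block (λ y → c (suc y))

  block-cong : ∀ {K} {c d : Fin K → ℕ} → (∀ x → c x ≡ d x) → block c ≡ block d
  block-cong {zero} _ = ≡.refl
  block-cong {suc K} c≗d = cong₂ (λ m xs → replicate m zero ++ map suc xs) (c≗d zero) (block-cong (λ x → c≗d (suc x)))

  block-++ : ∀ {K} (c d : Fin K → ℕ) → block c ++ block d ↭ block (λ x → c x + d x)
  block-++ {zero} c d = refl
  block-++ {suc K} c d = begin
    (Rc ++ Mc) ++ (Rd ++ Md)   ≡⟨ List.++-assoc Rc Mc (Rd ++ Md) ⟩
    Rc ++ (Mc ++ (Rd ++ Md))   ↭⟨ ++⁺ˡ Rc (shifts Mc Rd) ⟩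
    Rc ++ (Rd ++ (Mc ++ Md))   ≡⟨ List.++-assoc Rc Rd (Mc ++ Md) ⟨
    (Rc ++ Rd) ++ (Mc ++ Md)   ≡⟨ cong₂ _++_ (replicate-+ (c zero) (d zero) zero) (List.map-++ suc Bc Bd) ⟨
    replicate (c zero + d zero) zero ++ map suc (Bc ++ Bd)
                               ↭⟨ ++⁺ˡ (replicate (c zero + d zero) zero) (map⁺ suc (block-++ _ _)) ⟩
    block (λ x → c x + d x)    ∎
    where
    open PermutationReasoning
    Bc Bd : List (Fin K)
    Bc = block (λ x → c (suc x))
    Bd = block (λ x → d (suc x))
    Rc Rd Mc Md : List (Fin (suc K))
    Rc = replicate (c zero) zero
    Rd = replicate (d zero) zero
    Mc = map suc Bc
    Md = map suc Bd

  block-zero : ∀ {K} → block {K} (λ _ → 0) ≡ []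
  block-zero {zero} = ≡.refl
  block-zero {suc K} = cong (map suc) block-zero

-- Zero-sum sequences in coordinates

Code : ℕ → Set
Code k = Fin (suc k)

module Pieces {k : ℕ} (n : Fin k → ℕ) where

  open ≡ using (subst; subst₂; cong)

  -- A piece stands for a nonempty plus-minus zero-sum sequence over {e₀, e₁, …, e_k} with
  -- ord e_l = n l and e₀ = Σ c l · e_l: code zero is e₀, code suc l is e_l, and pos, neg count
  -- the occurrences taken with sign + and −.
  Balanced : (Fin k → ℕ) → (Code k → ℕ) → (Code k → ℕ) → Set
  Balanced c pos neg = ∀ l → pos zero * c l + pos (suc l) ≡ neg zero * c l + neg (suc l) mod n l

  record Piece (c : Fin k → ℕ) : Set where
    field
      pos neg  : Code k → ℕ
      balanced : Balanced c pos neg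
      nonempty : ∃[ x ] 0 < pos x + neg x

    size : Code k → ℕ
    size x = pos x + neg x

  open Piece public

  balanced-resp : ∀ {c p p′ q q′} → (∀ x → p x ≡ p′ x) → (∀ x → q x ≡ q′ x) → Balanced c p q → Balanced c p′ q′
  balanced-resp {c} p≗p′ q≗q′ bal l = subst₂ (λ u v → u ≡ v mod n l)
    (≡.cong₂ (λ z s → z * c l + s) (p≗p′ zero) (p≗p′ (suc l)))
    (≡.cong₂ (λ z s → z * c l + s) (q≗q′ zero) (q≗q′ (suc l)))
    (bal l)

  Indecomposable : (Fin k → ℕ) → (Code k → ℕ) → Set
  Indecomposable c s = (A B : Piece c) → (∀ x → size A x + size B x ≡ s x) → ⊥

  empty-piece : ∀ {c} (A : Piece c) → (∀ x → size A x ≡ 0) → ⊥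
  empty-piece A empty with x , 0<size ← nonempty A = <-irrefl (≡.sym (empty x)) 0<size

  indecomposable-resp : ∀ {c s s′} → (∀ x → s x ≡ s′ x) → Indecomposable c s → Indecomposable c s′
  indecomposable-resp s≗s′ indec A B sizes = indec A B (λ x → ≡.trans (sizes x) (≡.sym (s≗s′ x)))

  concentrated : ∀ {c} (A : Piece c) x₀ → (∀ x → x ≢ x₀ → size A x ≡ 0) → 0 < size A x₀
  concentrated A x₀ elsewhere with x , 0<size ← nonempty A with x ≟ x₀
  ... | yes ≡.refl = 0<size
  ... | no x≢x₀ = ⊥-elim (<-irrefl (≡.sym (elsewhere x x≢x₀)) 0<size)

  Complementary : (Fin k → ℕ) → (Fin k → ℕ) → Set
  Complementary c c′ = ∀ l → c l ≡ c′ l ⊎ c l + c′ l ≡ n l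

  complementary-sym : ∀ {c c′} → Complementary c c′ → Complementary c′ c
  complementary-sym {c} {c′} o l with o l
  ... | inj₁ c≡c′ = inj₁ (≡.sym c≡c′)
  ... | inj₂ c+c′≡n = inj₂ (≡.trans (+-comm (c′ l) (c l)) c+c′≡n)

  module _ {c c′} (o : Complementary c c′) where

    -- Where c′ l = n l − c l the coefficient changes sign, so the signs of the code suc l are swapped.
    private
      swapped : (Code k → ℕ) → (Code k → ℕ) → Code k → ℕ
      swapped p q zero = p zero
      swapped p q (suc l) = [ (λ _ → p (suc l)) , (λ _ → q (suc l)) ]′ (o l)

      swapped-size : ∀ p q x → swapped p q x + swapped q p x ≡ p x + q x
      swapped-size p q zero = ≡.refl
      swapped-size p q (suc l) with o l
      ... | inj₁ _ = ≡.refl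
      ... | inj₂ _ = +-comm (q (suc l)) (p (suc l))

      swapped-balanced : ∀ p q → Balanced c p q → Balanced c′ (swapped p q) (swapped q p)
      swapped-balanced p q bal l with o l
      ... | inj₁ c≡c′ = subst (λ d → p zero * d + p (suc l) ≡ q zero * d + q (suc l) mod n l) c≡c′ (bal l)
      ... | inj₂ c+c′≡n = ≡-mod-complement (p zero) (q zero) (p (suc l)) (q (suc l)) c+c′≡n (bal l)

    reorient : Piece c → Piece c′
    reorient A = record
      { pos = swapped (pos A) (neg A)
      ; neg = swapped (neg A) (pos A)
      ; balanced = swapped-balanced (pos A) (neg A) (balanced A)
      ; nonempty = let x , 0<size = nonempty A in x , subst (0 <_) (≡.sym (swapped-size (pos A) (neg A) x)) 0<size
      }

    size-reorient : ∀ A x → size (reorient A) x ≡ size A x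
    size-reorient A = swapped-size (pos A) (neg A)

  indecomposable-reorient : ∀ {c c′ s} → Complementary c c′ → Indecomposable c′ s → Indecomposable c s
  indecomposable-reorient o indec A B sizes = indec (reorient o A) (reorient o B) λ x →
    ≡.trans (≡.cong₂ _+_ (size-reorient o A x) (size-reorient o B x)) (sizes x)

  private
    no-shift : ∀ P M → P + M ≡ 0 → ∀ {m C p q} → P * C + p ≡ M * C + q mod m → p ≡ q mod m
    no-shift zero zero _ eq = eq

    one-shift : ∀ P M → P + M ≡ 1 → ∀ {m C p q} → P * C + p ≡ M * C + q mod m →
      ∃[ x ] ∃[ y ] x + y ≡ p + q × (C + x ≡ y mod m)
    one-shift 1 0 _ {m} {C} {p} {q} eq =
      p , q , ≡.refl , subst (λ u → u + p ≡ q mod m) (+-identityʳ C) eq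
    one-shift 0 1 _ {m} {C} {p} {q} eq =
      q , p , +-comm q p , ≡-mod-sym (subst (λ u → p ≡ u + q mod m) (+-identityʳ C) eq)
    one-shift zero zero ()
    one-shift zero (suc (suc _)) ()
    one-shift (suc zero) (suc _) ()
    one-shift (suc (suc _)) _ ()

    two-shift : ∀ P M → P + M ≡ 2 →
      (∀ {m C p q} → P * C + p ≡ M * C + q mod m → ∃[ x ] ∃[ y ] x + y ≡ p + q × (C + C + x ≡ y mod m)) ⊎
      (∀ {m C p q} → P * C + p ≡ M * C + q mod m → p ≡ q mod m)
    two-shift 2 0 _ = inj₁ λ {m} {C} {p} {q} eq →
      p , q , ≡.refl , subst (λ u → C + u + p ≡ q mod m) (+-identityʳ C) eq
    two-shift 0 2 _ = inj₁ λ {m} {C} {p} {q} eq →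
      q , p , +-comm q p , ≡-mod-sym (subst (λ u → p ≡ C + u + q mod m) (+-identityʳ C) eq)
    two-shift 1 1 _ = inj₂ λ {m} {C} eq → ≡-mod-cancelˡ (C + 0) eq
    two-shift zero zero ()
    two-shift zero (suc zero) ()
    two-shift zero (suc (suc (suc _))) ()
    two-shift (suc zero) zero ()
    two-shift (suc zero) (suc (suc _)) ()
    two-shift (suc (suc zero)) (suc _) ()
    two-shift (suc (suc (suc _))) _ ()

  balanced-shift₀ : ∀ {c} (A : Piece c) → size A zero ≡ 0 →
    ∀ l → pos A (suc l) ≡ neg A (suc l) mod n l
  balanced-shift₀ A s₀ l = no-shift (pos A zero) (neg A zero) s₀ (balanced A l)

  balanced-shift₁ : ∀ {c} (A : Piece c) → size A zero ≡ 1 →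
    ∀ l → ∃[ x ] ∃[ y ] x + y ≡ size A (suc l) × (c l + x ≡ y mod n l)
  balanced-shift₁ A s₀ l = one-shift (pos A zero) (neg A zero) s₀ (balanced A l)

  balanced-shift₂ : ∀ {c} (A : Piece c) → size A zero ≡ 2 →
    (∀ l → ∃[ x ] ∃[ y ] x + y ≡ size A (suc l) × (c l + c l + x ≡ y mod n l)) ⊎
    (∀ l → pos A (suc l) ≡ neg A (suc l) mod n l)
  balanced-shift₂ A s₀ with two-shift (pos A zero) (neg A zero) s₀
  ... | inj₁ same-sign = inj₁ λ l → same-sign (balanced A l)
  ... | inj₂ opposite-signs = inj₂ λ l → opposite-signs (balanced A l)

  private
    δ-self-multiple : ∀ m → δ m m * n m + 0 ≡ n m
    δ-self-multiple m = ≡.trans (+-identityʳ _) (≡.trans (cong (_* n m) (δ-refl m)) (+-identityʳ (n m)))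

  spike : ∀ {c} (m : Fin k) → 0 < n m → Piece c
  spike m 0<n = record
    { pos = λ { zero → 0 ; (suc l) → δ m l * n l }
    ; neg = λ _ → 0
    ; balanced = λ l → δ m l , inj₂ ≡.refl
    ; nonempty = suc m , subst (0 <_) (≡.sym (δ-self-multiple m)) 0<n
    }

  size-spike-self : ∀ {c} m (0<n : 0 < n m) → size (spike {c} m 0<n) (suc m) ≡ n m
  size-spike-self m _ = δ-self-multiple m

  size-spike-other : ∀ {c} m (0<n : 0 < n m) {l} → m ≢ l → size (spike {c} m 0<n) (suc l) ≡ 0
  size-spike-other m _ {l} m≢l = ≡.trans (+-identityʳ _) (cong (_* n l) (δ-≢ m≢l))

  spike-indecomposable : ∀ {c} m (0<n : 0 < n m) → ¬ 2 ∣ n m → Indecomposable c (size (spike {c} m 0<n))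
  spike-indecomposable {c} m 0<n odd A B sizes =
    two-balanced odd (balanced-shift₀ A A₀ m) (balanced-shift₀ B B₀ m)
      (concentrated A (suc m) (λ x x≢ → m+n≡0⇒m≡0 (size A x) (outside x x≢)))
      (concentrated B (suc m) (λ x x≢ → m+n≡0⇒n≡0 (size A x) (outside x x≢)))
      (≡.trans (sizes (suc m)) (size-spike-self {c} m 0<n))
    where
    A₀ : size A zero ≡ 0
    A₀ = m+n≡0⇒m≡0 (size A zero) (sizes zero)
    B₀ : size B zero ≡ 0
    B₀ = m+n≡0⇒n≡0 (size A zero) (sizes zero)
    outside : ∀ x → x ≢ suc m → size A x + size B x ≡ 0
    outside zero _ = sizes zero
    outside (suc l) l≢m = ≡.trans (sizes (suc l)) (size-spike-other {c} m 0<n (λ m≡l → l≢m (cong suc (≡.sym m≡l))))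

module Realisation {c ℓ : Level} (G : AbelianGroup c ℓ) {k : ℕ} (e : Fin k → AbelianGroup.Carrier G)
  (n a : Fin k → ℕ) (indep : Independent G k e) (ho : ∀ l → HasOrder G (e l) (n l)) where

  open AbelianGroup G
  open import Data.List.Relation.Unary.All using ([]; _∷_)
  open import Data.List.Relation.Binary.Pointwise using ([]; _∷_)
  open import Algebra.Properties.AbelianGroup G using (ε⁻¹≈ε; ⁻¹-∙-comm; x∙y⁻¹≈ε⇒x≈y; x≈y⇒x∙y⁻¹≈ε)
  open import Algebra.Properties.CommutativeSemigroup commutativeSemigroup using (x∙yz≈y∙xz)
  open import Algebra.Properties.Monoid.Mult monoid using (×-homo-+) renaming (_×_ to _·_)
  open import Algebra.Properties.CommutativeMonoid.Sum commutativeMonoid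
    using (sum; ∑-distrib-+; sum-cong-≋; sum-replicate-zero)
  import Relation.Binary.Reasoning.Setoid setoid as ≈-Reasoning
  open import Data.List.Relation.Binary.Permutation.Setoid setoid as ↭ₛ using (_↭_)
  open import Data.List.Relation.Binary.Permutation.Setoid.Properties setoid using (All-resp-↭)
  open Pieces n

  e₀ : Carrier
  e₀ = sumFin G k (λ l → natMul G (a l) (e l))

  el : Code k → Carrier
  el zero = e₀
  el (suc l) = e l

  G₀ : Carrier → Set ℓ
  G₀ g = (g ≈ e₀) ⊎ (∃[ l ] g ≈ e l)

  coordinate : Code k → Fin k → ℕ
  coordinate zero = a
  coordinate (suc m) = δ m

  el≈∑ : ∀ x → el x ≈ sum (λ l → coordinate x l · e l)
  el≈∑ zero = begin
    sumFin G k (λ l → natMul G (a l) (e l))   ≡⟨ sumFin≡sum G k _ ⟩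
    sum (λ l → natMul G (a l) (e l))          ≈⟨ sum-cong-≋ (λ l → reflexive (natMul≡· G (a l) (e l))) ⟩
    sum (λ l → a l · e l)                     ∎
    where open ≈-Reasoning
  el≈∑ (suc m) = sym (∑-δ G m e)

  weight : List (Code k) → Fin k → ℕ
  weight cs l = count zero cs * a l + count (suc l) cs

  weight-∷ : ∀ x cs l → weight (x ∷ cs) l ≡ coordinate x l + weight cs l
  weight-∷ zero cs l = +-assoc (a l) _ _
  weight-∷ (suc m) cs l = ℕ-Comm.x∙yz≈y∙xz (count zero cs * a l) (δ m l) _

  sumCodes : List (Code k) → Carrier
  sumCodes [] = ε
  sumCodes (x ∷ cs) = el x ∙ sumCodes cs

  sumCodes≈∑ : ∀ cs → sumCodes cs ≈ sum (λ l → weight cs l · e l)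
  sumCodes≈∑ [] = sym (sum-replicate-zero k)
  sumCodes≈∑ (x ∷ cs) = begin
    el x ∙ sumCodes cs
      ≈⟨ ∙-cong (el≈∑ x) (sumCodes≈∑ cs) ⟩
    sum (λ l → coordinate x l · e l) ∙ sum (λ l → weight cs l · e l)
      ≈⟨ ∑-distrib-+ (λ l → coordinate x l · e l) (λ l → weight cs l · e l) ⟨
    sum (λ l → coordinate x l · e l ∙ weight cs l · e l)
      ≈⟨ sum-cong-≋ (λ l → trans (sym (×-homo-+ (e l) (coordinate x l) (weight cs l)))
                              (reflexive (≡.cong (_· e l) (≡.sym (weight-∷ x cs l))))) ⟩
    sum (λ l → weight (x ∷ cs) l · e l)
      ∎
    where open ≈-Reasoning

  sumCodes≈⇒balanced : ∀ P N → sumCodes P ≈ sumCodes N → Balanced a (λ x → count x P) (λ x → count x N)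
  sumCodes≈⇒balanced P N eq l = ·≈·⇒≡-mod G (e l) (weight P l) (weight N l) (ho l)
    (independent⇒·≈· G indep (weight P) (weight N) (trans (sym (sumCodes≈∑ P)) (trans eq (sumCodes≈∑ N))) l)

  balanced⇒sumCodes≈ : ∀ P N → Balanced a (λ x → count x P) (λ x → count x N) → sumCodes P ≈ sumCodes N
  balanced⇒sumCodes≈ P N bal = begin
    sumCodes P                      ≈⟨ sumCodes≈∑ P ⟩
    sum (λ l → weight P l · e l)    ≈⟨ sum-cong-≋ (λ l → ≡-mod⇒·≈· G (e l) (weight P l) (weight N l) (ho l) (bal l)) ⟩
    sum (λ l → weight N l · e l)    ≈⟨ sumCodes≈∑ N ⟨
    sumCodes N                      ∎
    where open ≈-Reasoning

  code : ∀ {g} → G₀ g → Code k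
  code (inj₁ _) = zero
  code (inj₂ (l , _)) = suc l

  code-≈ : ∀ {g} (p : G₀ g) → g ≈ el (code p)
  code-≈ (inj₁ g≈e₀) = g≈e₀
  code-≈ (inj₂ (_ , g≈eₗ)) = g≈eₗ

  codes : ∀ {xs} → All G₀ xs → List (Code k)
  codes = All.reduce code

  el∈G₀ : ∀ x → G₀ (el x)
  el∈G₀ zero = inj₁ refl
  el∈G₀ (suc l) = inj₂ (l , refl)

  all-el∈G₀ : ∀ cs → All G₀ (map el cs)
  all-el∈G₀ [] = []
  all-el∈G₀ (x ∷ cs) = el∈G₀ x ∷ all-el∈G₀ cs

  codes-all-el : ∀ cs → codes (all-el∈G₀ cs) ≡ cs
  codes-all-el [] = ≡.refl
  codes-all-el (zero ∷ cs) = ≡.cong (zero ∷_) (codes-all-el cs)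
  codes-all-el (suc l ∷ cs) = ≡.cong (suc l ∷_) (codes-all-el cs)

  codes-++ : ∀ {xs ys} (ps : All G₀ xs) (qs : All G₀ ys) → codes (All.++⁺ ps qs) ≡ codes ps ++ codes qs
  codes-++ [] qs = ≡.refl
  codes-++ (p ∷ ps) qs = ≡.cong (code p ∷_) (codes-++ ps qs)

  positives negatives : List Bool → ∀ {xs} → All G₀ xs → List (Code k)
  positives (true ∷ ss) (p ∷ ps) = code p ∷ positives ss ps
  positives (false ∷ ss) (p ∷ ps) = positives ss ps
  positives _ _ = []
  negatives (true ∷ ss) (p ∷ ps) = negatives ss ps
  negatives (false ∷ ss) (p ∷ ps) = code p ∷ negatives ss ps
  negatives _ _ = []

  G₀-resp-≈ : ∀ {g h} → g ≈ h → G₀ g → G₀ h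
  G₀-resp-≈ g≈h (inj₁ g≈e₀) = inj₁ (trans (sym g≈h) g≈e₀)
  G₀-resp-≈ g≈h (inj₂ (l , g≈eₗ)) = inj₂ (l , trans (sym g≈h) g≈eₗ)

  signedSum-split : ∀ ss {xs} (ps : All G₀ xs) →
    signedSum G ss xs ≈ sumCodes (positives ss ps) ∙ sumCodes (negatives ss ps) ⁻¹
  signedSum-split (true ∷ ss) (p ∷ ps) = begin
    _ ∙ signedSum G ss _                 ≈⟨ ∙-cong (code-≈ p) (signedSum-split ss ps) ⟩
    el (code p) ∙ (Σ⁺ ∙ Σ⁻ ⁻¹)            ≈⟨ assoc _ _ _ ⟨
    el (code p) ∙ Σ⁺ ∙ Σ⁻ ⁻¹              ∎
    where open ≈-Reasoning
          Σ⁺ Σ⁻ : Carrier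
          Σ⁺ = sumCodes (positives ss ps)
          Σ⁻ = sumCodes (negatives ss ps)
  signedSum-split (false ∷ ss) (p ∷ ps) = begin
    _ ⁻¹ ∙ signedSum G ss _              ≈⟨ ∙-cong (⁻¹-cong (code-≈ p)) (signedSum-split ss ps) ⟩
    el (code p) ⁻¹ ∙ (Σ⁺ ∙ Σ⁻ ⁻¹)         ≈⟨ x∙yz≈y∙xz _ _ _ ⟩
    Σ⁺ ∙ (el (code p) ⁻¹ ∙ Σ⁻ ⁻¹)         ≈⟨ ∙-congˡ (⁻¹-∙-comm _ _) ⟩
    Σ⁺ ∙ (el (code p) ∙ Σ⁻) ⁻¹            ∎
    where open ≈-Reasoning
          Σ⁺ Σ⁻ : Carrier
          Σ⁺ = sumCodes (positives ss ps)
          Σ⁻ = sumCodes (negatives ss ps)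
  signedSum-split [] _ = sym (x≈y⇒x∙y⁻¹≈ε refl)
  signedSum-split (true ∷ _) [] = sym (x≈y⇒x∙y⁻¹≈ε refl)
  signedSum-split (false ∷ _) [] = sym (x≈y⇒x∙y⁻¹≈ε refl)

  count-codes-split : ∀ ss {xs} (ps : All G₀ xs) → length ss ≡ length xs → ∀ x →
    count x (codes ps) ≡ count x (positives ss ps) + count x (negatives ss ps)
  count-codes-split [] [] _ x = ≡.refl
  count-codes-split (true ∷ ss) (p ∷ ps) eq x =
    ≡.trans (≡.cong (δ (code p) x +_) (count-codes-split ss ps (suc-injective eq) x))
      (≡.sym (+-assoc (δ (code p) x) (count x (positives ss ps)) (count x (negatives ss ps))))
  count-codes-split (false ∷ ss) (p ∷ ps) eq x =
    ≡.trans (≡.cong (δ (code p) x +_) (count-codes-split ss ps (suc-injective eq) x))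
      (ℕ-Comm.x∙yz≈y∙xz (δ (code p) x) (count x (positives ss ps)) (count x (negatives ss ps)))

  piece-of : ∀ {T} (ps : All G₀ T) → IsPMZeroSum G T → T ≢ [] →
    Σ (Piece a) λ A → ∀ x → size A x ≡ count x (codes ps)
  piece-of [] _ T≢[] = ⊥-elim (T≢[] ≡.refl)
  piece-of (p ∷ ps) (ss , len , zero-sum) _ = A , λ x → ≡.sym (count-codes-split ss (p ∷ ps) len x)
    where
    P N : List (Code k)
    P = positives ss (p ∷ ps)
    N = negatives ss (p ∷ ps)
    A : Piece a
    A = record
      { pos = λ x → count x P
      ; neg = λ x → count x N
      ; balanced = sumCodes≈⇒balanced P N (x∙y⁻¹≈ε⇒x≈y _ _ (trans (sym (signedSum-split ss (p ∷ ps))) zero-sum))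
      ; nonempty = code p , ≡.subst (0 <_) (count-codes-split ss (p ∷ ps) len (code p))
                                    (≡.subst (λ d → 0 < d + count (code p) (codes ps)) (≡.sym (δ-refl (code p))) (s≤s z≤n))
      }

  signedSum-positive : ∀ P → signedSum G (replicate (length P) true) (map el P) ≈ sumCodes P
  signedSum-positive [] = refl
  signedSum-positive (x ∷ P) = ∙-congˡ (signedSum-positive P)

  signedSum-negative : ∀ N → signedSum G (replicate (length N) false) (map el N) ≈ sumCodes N ⁻¹
  signedSum-negative [] = sym ε⁻¹≈ε
  signedSum-negative (x ∷ N) = trans (∙-congˡ (signedSum-negative N)) (⁻¹-∙-comm _ _)

  codesOf : Piece a → List (Code k)
  codesOf A = block (pos A) ++ block (neg A)

  count-codesOf : ∀ A x → count x (codesOf A) ≡ size A x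
  count-codesOf A x = ≡.trans (count-++ x (block (pos A)) _) (≡.cong₂ _+_ (count-block (pos A) x) (count-block (neg A) x))

  realise : Piece a → List Carrier
  realise A = map el (codesOf A)

  InH-realise : ∀ A → InH G G₀ (realise A)
  InH-realise A = all-el∈G₀ (P ++ N) , signs , length-signs , zero-sum
    where
    P N : List (Code k)
    P = block (pos A)
    N = block (neg A)
    signs : List Bool
    signs = replicate (length P) true ++ replicate (length N) false
    length-signs : length signs ≡ length (realise A)
    length-signs = ≡.trans (List.length-++ (replicate (length P) true))
      (≡.trans (≡.cong₂ _+_ (List.length-replicate (length P)) (List.length-replicate (length N)))
        (≡.sym (≡.trans (List.length-map el (P ++ N)) (List.length-++ P))))
    zero-sum : signedSum G signs (realise A) ≈ ε
    zero-sum = begin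
      signedSum G signs (map el (P ++ N))                ≡⟨ ≡.cong (signedSum G signs) (List.map-++ el P N) ⟩
      signedSum G signs (map el P ++ map el N)           ≈⟨ signedSum-++ G (replicate (length P) true) _ (map el N)
                                                              (≡.trans (List.length-replicate (length P)) (≡.sym (List.length-map el P))) ⟩
      signedSum G (replicate (length P) true) (map el P) ∙ signedSum G (replicate (length N) false) (map el N)
                                                          ≈⟨ ∙-cong (signedSum-positive P) (signedSum-negative N) ⟩
      sumCodes P ∙ sumCodes N ⁻¹                          ≈⟨ x≈y⇒x∙y⁻¹≈ε (balanced⇒sumCodes≈ P N
                                                              (balanced-resp (λ x → ≡.sym (count-block (pos A) x))
                                                                             (λ x → ≡.sym (count-block (neg A) x)) (balanced A))) ⟩
      ε                                                   ∎
      where open ≈-Reasoning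

  coordinates-injective : ∀ {i j} → i ≢ j → a i ≢ 0 → a j ≢ 0 →
    ∀ x y → (∀ l → coordinate x l ≡ coordinate y l) → x ≡ y
  coordinates-injective i≢j aᵢ≢0 aⱼ≢0 zero zero _ = ≡.refl
  coordinates-injective {i} {j} i≢j aᵢ≢0 aⱼ≢0 zero (suc m) same =
    ⊥-elim (i≢j (≡.trans (≡.sym (δ≢0⇒≡ m i (λ δ≡0 → aᵢ≢0 (≡.trans (same i) δ≡0))))
                         (δ≢0⇒≡ m j (λ δ≡0 → aⱼ≢0 (≡.trans (same j) δ≡0)))))
  coordinates-injective {i} {j} i≢j aᵢ≢0 aⱼ≢0 (suc m) zero same =
    ⊥-elim (i≢j (≡.trans (≡.sym (δ≢0⇒≡ m i (λ δ≡0 → aᵢ≢0 (≡.trans (≡.sym (same i)) δ≡0))))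
                         (δ≢0⇒≡ m j (λ δ≡0 → aⱼ≢0 (≡.trans (≡.sym (same j)) δ≡0)))))
  coordinates-injective _ _ _ (suc m) (suc m′) same =
    ≡.cong suc (≡.sym (δ≢0⇒≡ m′ m (λ δ≡0 → 1≢0 (≡.trans (≡.sym (δ-refl m)) (≡.trans (same m) δ≡0)))))
    where 1≢0 : 1 ≢ 0
          1≢0 ()

  el-injective : (∀ l → a l < n l) → (∀ l → 1 < n l) → ∀ {i j} → i ≢ j → a i ≢ 0 → a j ≢ 0 →
    ∀ {x y} → el x ≈ el y → x ≡ y
  el-injective a<n 1<n i≢j aᵢ≢0 aⱼ≢0 {x} {y} eq = coordinates-injective i≢j aᵢ≢0 aⱼ≢0 x y λ l →
    ≡-mod⇒≡ (·≈·⇒≡-mod G (e l) _ _ (ho l)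
              (independent⇒·≈· G indep (coordinate x) (coordinate y) (trans (sym (el≈∑ x)) (trans eq (el≈∑ y))) l))
            (coordinate< x l) (coordinate< y l)
    where
    coordinate< : ∀ x l → coordinate x l < n l
    coordinate< zero l = a<n l
    coordinate< (suc m) l = <-≤-trans (s≤s (δ≤1 m l)) (1<n l)

  totalSize : List (Piece a) → Code k → ℕ
  totalSize [] x = 0
  totalSize (A ∷ As) x = size A x + totalSize As x

  concat-codesOf-↭ : ∀ As → concat (map codesOf As) ↭.↭ block (totalSize As)
  concat-codesOf-↭ [] = ↭.↭-reflexive (≡.sym block-zero)
  concat-codesOf-↭ (A ∷ As) = ↭.trans (↭.++⁺ (block-++ (pos A) (neg A)) (concat-codesOf-↭ As))
                                      (block-++ (size A) (totalSize As))

  concat-realise : ∀ As → concat (map realise As) ≡ map el (concat (map codesOf As))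
  concat-realise [] = ≡.refl
  concat-realise (A ∷ As) = ≡.trans (≡.cong (realise A ++_) (concat-realise As)) (≡.sym (List.map-++ el (codesOf A) _))

  concat-realise-↭ : ∀ As → concat (map realise As) ↭ map el (block (totalSize As))
  concat-realise-↭ As = ↭ₛ.↭-trans (↭ₛ.↭-reflexive (concat-realise As))
                                   (↭.↭⇒↭ₛ′ isEquivalence (↭.map⁺ el (concat-codesOf-↭ As)))

  realise-↭ : ∀ As Bs → (∀ x → totalSize As x ≡ totalSize Bs x) → concat (map realise As) ↭ concat (map realise Bs)
  realise-↭ As Bs same = ↭ₛ.↭-trans (concat-realise-↭ As)
    (↭ₛ.↭-trans (↭ₛ.↭-reflexive (≡.cong (map el) (block-cong same))) (↭ₛ.↭-sym (concat-realise-↭ Bs)))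

  module _ (el-injective : ∀ {x y} → el x ≈ el y → x ≡ y) where

    code-unique : ∀ {g h} (p : G₀ g) (q : G₀ h) → g ≈ h → code p ≡ code q
    code-unique p q g≈h = el-injective (trans (sym (code-≈ p)) (trans g≈h (code-≈ q)))

    codes-pointwise : ∀ {xs ys} → Pointwise _≈_ xs ys → (ps : All G₀ xs) (qs : All G₀ ys) → codes ps ≡ codes qs
    codes-pointwise [] [] [] = ≡.refl
    codes-pointwise (g≈h ∷ pw) (p ∷ ps) (q ∷ qs) = ≡.cong₂ _∷_ (code-unique p q g≈h) (codes-pointwise pw ps qs)

    codes-↭ : ∀ {xs ys} → xs ↭ ys → (ps : All G₀ xs) (qs : All G₀ ys) → codes ps ↭.↭ codes qs
    codes-↭ (↭ₛ.refl pw) ps qs = ↭.↭-reflexive (codes-pointwise pw ps qs)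
    codes-↭ (↭ₛ.prep g≈h r) (p ∷ ps) (q ∷ qs) rewrite code-unique p q g≈h =
      ↭.prep (code q) (codes-↭ r ps qs)
    codes-↭ (↭ₛ.swap g≈g′ h≈h′ r) (p ∷ p′ ∷ ps) (q′ ∷ q ∷ qs)
      rewrite code-unique p q g≈g′ | code-unique p′ q′ h≈h′ = ↭.swap (code q) (code q′) (codes-↭ r ps qs)
    codes-↭ (↭ₛ.trans {ys = zs} r r′) ps qs = ↭.trans (codes-↭ r ps rs) (codes-↭ r′ rs qs)
      where rs : All G₀ zs
            rs = All-resp-↭ G₀-resp-≈ r ps

    realise-nonempty : ∀ A → realise A ≢ []
    realise-nonempty A realise≡[] with x , 0<size ← nonempty A with codesOf A in codes≡
    ... | [] = <-irrefl (≡.sym (≡.trans (≡.sym (count-codesOf A x)) (≡.cong (count x) codes≡))) 0<size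
    ... | _ ∷ _ with () ← realise≡[]

    atom : ∀ A → Indecomposable a (size A) → IsAtom G G₀ (realise A)
    atom A indecomposable = InH-realise A , realise-nonempty A ,
      λ (T , V , (psT , zsT) , (psV , zsV) , T≢[] , V≢[] , A↭T++V) →
        let B , sizeB = piece-of psT zsT T≢[]
            C , sizeC = piece-of psV zsV V≢[]
        in indecomposable B C (sizes-add psT psV A↭T++V B C sizeB sizeC)
      where
      sizes-add : ∀ {T V} (psT : All G₀ T) (psV : All G₀ V) → realise A ↭ T ++ V → ∀ B C →
        (∀ x → size B x ≡ count x (codes psT)) → (∀ x → size C x ≡ count x (codes psV)) →
        ∀ x → size B x + size C x ≡ size A x
      sizes-add psT psV A↭T++V B C sizeB sizeC x = begin
        size B x + size C x                           ≡⟨ ≡.cong₂ _+_ (sizeB x) (sizeC x) ⟩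
        count x (codes psT) + count x (codes psV)     ≡⟨ count-++ x (codes psT) (codes psV) ⟨
        count x (codes psT ++ codes psV)              ≡⟨ ≡.cong (count x) (codes-++ psT psV) ⟨
        count x (codes (All.++⁺ psT psV))             ≡⟨ count-↭ x (codes-↭ A↭T++V (all-el∈G₀ _) (All.++⁺ psT psV)) ⟨
        count x (codes (all-el∈G₀ (codesOf A)))       ≡⟨ ≡.cong (count x) (codes-all-el (codesOf A)) ⟩
        count x (codesOf A)                           ≡⟨ count-codesOf A x ⟩
        size A x                                      ∎
        where open ≡.≡-Reasoning

-- The element U² with factorisations of lengths 2 and 3

module Construction {c ℓ : Level} (G : AbelianGroup c ℓ) {k : ℕ} (e : Fin k → AbelianGroup.Carrier G)
  (n a : Fin k → ℕ) (indep : Independent G k e) (ho : ∀ l → HasOrder G (e l) (n l))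
  (odd : ∀ l → ¬ 2 ∣ n l) (3≤n : ∀ l → 3 ≤ n l) (a<n : ∀ l → a l < n l)
  {i j : Fin k} (i≢j : i ≢ j) (aᵢ≢0 : a i ≢ 0) (aⱼ≢0 : a j ≢ 0) where

  open Realisation G e n a indep ho
  open Pieces n
  open import Data.List.Relation.Unary.All using ([]; _∷_)

  private
    half : ∀ l → ∃[ b ] (b + b < n l) × (a l ≡ b ⊎ a l + b ≡ n l) × (a l ≢ 0 → 0 < b)
    half l = half-representative (odd l) (a<n l)

  b : Fin k → ℕ
  b l = proj₁ (half l)

  b+b<n : ∀ l → b l + b l < n l
  b+b<n l = proj₁ (proj₂ (half l))

  b<n : ∀ l → b l < n l
  b<n l = ≤-<-trans (m≤m+n (b l) (b l)) (b+b<n l)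

  a~b : Complementary a b
  a~b l = proj₁ (proj₂ (proj₂ (half l)))

  special : Fin k → Bool
  special l = does (i ≟ l) ∨ does (j ≟ l)

  0<b : ∀ l → special l ≡ true → 0 < b l
  0<b l sp with i ≟ l | j ≟ l
  ... | yes ≡.refl | _ = proj₂ (proj₂ (proj₂ (half i))) aᵢ≢0
  ... | no _ | yes ≡.refl = proj₂ (proj₂ (proj₂ (half j))) aⱼ≢0
  ... | no _ | no _ with () ← sp

  special-i : special i ≡ true
  special-i with i ≟ i
  ... | yes _ = ≡.refl
  ... | no i≢i = ⊥-elim (i≢i ≡.refl)

  special-j : special j ≡ true
  special-j with i ≟ j | j ≟ j
  ... | yes _ | _ = ≡.refl
  ... | no _ | yes _ = ≡.refl
  ... | no _ | no j≢j = ⊥-elim (j≢j ≡.refl)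

  special-other : ∀ {l} → i ≢ l → j ≢ l → special l ≡ false
  special-other {l} i≢l j≢l with i ≟ l | j ≟ l
  ... | yes i≡l | _ = ⊥-elim (i≢l i≡l)
  ... | no _ | yes j≡l = ⊥-elim (j≢l j≡l)
  ... | no _ | no _ = ≡.refl

  module Shifted (s : ℕ) (t : Fin k → ℕ) (s*b≡t : ∀ l → s * b l ≡ t l) (0<s : 0 < s)
                 (t<n : ∀ l → t l < n l) (0<t : ∀ l → special l ≡ true → 0 < t l) where

    private
      pos′ neg′ : Code k → ℕ
      pos′ zero = s
      pos′ (suc l) = if special l then n l ∸ t l else 0
      neg′ zero = 0
      neg′ (suc l) = if special l then 0 else t l

      balanced′ : Balanced b pos′ neg′
      balanced′ l with special l
      ... | true = 1 , inj₂ (≡.trans (+-identityʳ (n l)) (≡.sym (≡.trans (≡.cong (_+ (n l ∸ t l)) (s*b≡t l))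
                                                                        (m+[n∸m]≡n (<⇒≤ (t<n l))))))
      ... | false = ≡-mod-reflexive (≡.trans (+-identityʳ (s * b l)) (s*b≡t l))

    piece : Piece b
    piece = record { pos = pos′ ; neg = neg′ ; balanced = balanced′ ; nonempty = zero , ≡.subst (0 <_) (≡.sym (+-identityʳ s)) 0<s }

    size-cases : ∀ l → (special l ≡ true × size piece (suc l) + t l ≡ n l) ⊎ (special l ≡ false × size piece (suc l) ≡ t l)
    size-cases l with special l
    ... | true = inj₁ (≡.refl , ≡.trans (≡.cong (_+ t l) (+-identityʳ _)) (m∸n+n≡m (<⇒≤ (t<n l))))
    ... | false = inj₂ (≡.refl , ≡.refl)

    size-special : ∀ l → special l ≡ true → size piece (suc l) + t l ≡ n l
    size-special l sp with size-cases l
    ... | inj₁ (_ , S+t≡n) = S+t≡n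
    ... | inj₂ (nsp , _) with () ← ≡.trans (≡.sym sp) nsp

    size-ordinary : ∀ l → special l ≡ false → size piece (suc l) ≡ t l
    size-ordinary l nsp with size-cases l
    ... | inj₂ (_ , S≡t) = S≡t
    ... | inj₁ (sp , _) with () ← ≡.trans (≡.sym sp) nsp

    size-< : ∀ l → size piece (suc l) < n l
    size-< l with size-cases l
    ... | inj₁ (sp , S+t≡n) = <-≤-trans (m<m+n _ (0<t l sp)) (≤-reflexive S+t≡n)
    ... | inj₂ (_ , S≡t) = ≡.subst (_< n l) (≡.sym S≡t) (t<n l)

    zero-free-balanced : (X Y : Piece b) → size X zero ≡ 0 → (∀ x → size X x + size Y x ≡ size piece x) →
      ∀ l → pos X (suc l) ≡ neg X (suc l)
    zero-free-balanced X Y X₀ sizes l = ≡-mod⇒≡-sum (balanced-shift₀ X X₀ l)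
      (≤-<-trans (≤-trans (m≤m+n _ (size Y (suc l))) (≤-reflexive (sizes (suc l)))) (size-< l))

    vanishing : (X Y : Piece b) → size X zero ≡ 0 →
      (∀ l → ∃[ x ] ∃[ y ] x + y ≡ size Y (suc l) × (t l + x ≡ y mod n l)) →
      (∀ x → size X x + size Y x ≡ size piece x) → ⊥
    vanishing X Y X₀ Y-shifted sizes = empty-piece X λ { zero → X₀ ; (suc l) → X-vanishes l }
      where
      X-vanishes : ∀ l → size X (suc l) ≡ 0
      X-vanishes l = ≡.cong₂ _+_ p≡0 (≡.trans (≡.sym p≡q) p≡0)
        where
        p : ℕ
        p = pos X (suc l)
        p≡q : p ≡ neg X (suc l)
        p≡q = zero-free-balanced X Y X₀ sizes l
        sum : ∀ {x y} → x + y ≡ size Y (suc l) → p + p + (x + y) ≡ size piece (suc l)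
        sum x+y≡ = ≡.trans (≡.cong₂ (λ q u → p + q + u) p≡q x+y≡) (sizes (suc l))
        p≡0 : p ≡ 0
        p≡0 with x , y , x+y≡ , shifted ← Y-shifted l | size-cases l
        ... | inj₁ (sp , S+t≡n) = shifted-long p (odd l) (0<t l sp) shifted (≡.trans (≡.cong (_+ t l) (sum {x} {y} x+y≡)) S+t≡n)
        ... | inj₂ (_ , S≡t) = shifted-short p (odd l) (t<n l) shifted (≡.trans (sum {x} {y} x+y≡) S≡t)

  module U = Shifted 1 b (λ l → +-identityʳ (b l)) (s≤s z≤n) b<n 0<b
  module D = Shifted 2 (λ l → b l + b l) (λ l → ≡.cong (b l +_) (+-identityʳ (b l))) (s≤s z≤n) b+b<n
               (λ l sp → +-mono-< (0<b l sp) (0<b l sp))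

  U-indecomposable : Indecomposable b (size U.piece)
  U-indecomposable X Y sizes with +≡1 (size X zero) (size Y zero) (sizes zero)
  ... | inj₁ (X₀ , Y₁) = U.vanishing X Y X₀ (balanced-shift₁ Y Y₁) sizes
  ... | inj₂ (X₁ , Y₀) = U.vanishing Y X Y₀ (balanced-shift₁ X X₁) (λ x → ≡.trans (+-comm (size Y x) (size X x)) (sizes x))

  private
    D-two : (X Y : Piece b) → size X zero ≡ 0 → size Y zero ≡ 2 → (∀ x → size X x + size Y x ≡ size D.piece x) → ⊥
    D-two X Y X₀ Y₂ sizes with balanced-shift₂ Y Y₂
    ... | inj₁ same-sign = D.vanishing X Y X₀ same-sign sizes
    ... | inj₂ opposite = opposite-signs (pos X (suc i)) (odd i) (0<b i special-i) (opposite i)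
      (≡.trans (≡.cong (λ q → pos X (suc i) + q + size Y (suc i) + (b i + b i)) (D.zero-free-balanced X Y X₀ sizes i))
               (≡.trans (≡.cong (_+ (b i + b i)) (sizes (suc i))) (D.size-special i special-i)))

    D-one-one : (X Y : Piece b) → size X zero ≡ 1 → size Y zero ≡ 1 → (∀ x → size X x + size Y x ≡ size D.piece x) → ⊥
    D-one-one X Y X₁ Y₁ sizes
      with x₁ , y₁ , X≡ , shiftedX ← balanced-shift₁ X X₁ i | x₂ , y₂ , Y≡ , shiftedY ← balanced-shift₁ Y Y₁ i =
      two-shifted (odd i) (0<b i special-i) shiftedX shiftedY
        (≡.trans (≡.cong (_+ (b i + b i)) (≡.trans (≡.cong₂ _+_ X≡ Y≡) (sizes (suc i)))) (D.size-special i special-i))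

  D-indecomposable : Indecomposable b (size D.piece)
  D-indecomposable X Y sizes with +≡2 (size X zero) (size Y zero) (sizes zero)
  ... | inj₁ (X₀ , Y₂) = D-two X Y X₀ Y₂ sizes
  ... | inj₂ (inj₁ (X₁ , Y₁)) = D-one-one X Y X₁ Y₁ sizes
  ... | inj₂ (inj₂ (X₂ , Y₀)) = D-two Y X Y₀ X₂ (λ x → ≡.trans (+-comm (size Y x) (size X x)) (sizes x))

  private
    b~a : Complementary b a
    b~a = complementary-sym a~b

    0<n : ∀ l → 0 < n l
    0<n l = <-≤-trans (s≤s z≤n) (3≤n l)

  U′ D′ : Piece a
  U′ = reorient b~a U.piece
  D′ = reorient b~a D.piece

  W : Fin k → Piece a
  W m = spike m (0<n m)

  reoriented-indecomposable : ∀ A → Indecomposable b (size A) → Indecomposable a (size (reorient b~a A))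
  reoriented-indecomposable A indec =
    indecomposable-resp (λ x → ≡.sym (size-reorient b~a A x)) (indecomposable-reorient a~b indec)

  private
    w : Fin k → Fin k → ℕ
    w m l = size (W m) (suc l)

    position : ∀ l → l ≡ i ⊎ l ≡ j × i ≢ l ⊎ i ≢ l × j ≢ l
    position l with i ≟ l | j ≟ l
    ... | yes i≡l | _ = inj₁ (≡.sym i≡l)
    ... | no i≢l | yes j≡l = inj₂ (inj₁ (≡.sym j≡l , i≢l))
    ... | no i≢l | no j≢l = inj₂ (inj₂ (i≢l , j≢l))

    doubled-U : ∀ l → size U.piece (suc l) + size U.piece (suc l) ≡ size D.piece (suc l) + (w i l + w j l)
    doubled-U l with position l
    ... | inj₁ ≡.refl = begin
      _                                       ≡⟨ double-complement {u = size U.piece (suc i)} {size D.piece (suc i)} {b i}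
                                                   (U.size-special i special-i) (D.size-special i special-i) ⟩
      size D.piece (suc i) + n i              ≡⟨ ≡.cong (size D.piece (suc i) +_) (≡.sym (≡.trans
                                                   (≡.cong₂ _+_ (size-spike-self {a} i (0<n i))
                                                                (size-spike-other {a} j (0<n j) (λ j≡i → i≢j (≡.sym j≡i))))
                                                   (+-identityʳ (n i)))) ⟩
      size D.piece (suc i) + (w i i + w j i)  ∎
      where open ≡.≡-Reasoning
    ... | inj₂ (inj₁ (≡.refl , i≢j′)) = begin
      _                                       ≡⟨ double-complement {u = size U.piece (suc j)} {size D.piece (suc j)} {b j}
                                                   (U.size-special j special-j) (D.size-special j special-j) ⟩
      size D.piece (suc j) + n j              ≡⟨ ≡.cong (size D.piece (suc j) +_) (≡.sym
                                                   (≡.cong₂ _+_ (size-spike-other {a} i (0<n i) i≢j′) (size-spike-self {a} j (0<n j)))) ⟩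
      size D.piece (suc j) + (w i j + w j j)  ∎
      where open ≡.≡-Reasoning
    ... | inj₂ (inj₂ (i≢l , j≢l)) = begin
      _                                       ≡⟨ ≡.cong₂ _+_ (U.size-ordinary l ordinary) (U.size-ordinary l ordinary) ⟩
      b l + b l                               ≡⟨ +-identityʳ (b l + b l) ⟨
      b l + b l + 0                           ≡⟨ ≡.cong₂ _+_ (D.size-ordinary l ordinary)
                                                   (≡.cong₂ _+_ (size-spike-other {a} i (0<n i) i≢l)
                                                                (size-spike-other {a} j (0<n j) j≢l)) ⟨
      size D.piece (suc l) + (w i l + w j l)  ∎
      where open ≡.≡-Reasoning
            ordinary : special l ≡ false
            ordinary = special-other i≢l j≢l

  sizes-agree : ∀ x → totalSize (U′ ∷ U′ ∷ []) x ≡ totalSize (D′ ∷ W i ∷ W j ∷ []) x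
  sizes-agree zero = ≡.refl
  sizes-agree (suc l) = begin
    size U′ (suc l) + (size U′ (suc l) + 0)                   ≡⟨ ≡.cong (λ u → u + (u + 0)) (size-reorient b~a U.piece (suc l)) ⟩
    size U.piece (suc l) + (size U.piece (suc l) + 0)         ≡⟨ ≡.cong (size U.piece (suc l) +_) (+-identityʳ _) ⟩
    size U.piece (suc l) + size U.piece (suc l)               ≡⟨ doubled-U l ⟩
    size D.piece (suc l) + (w i l + w j l)                    ≡⟨ ≡.cong₂ (λ d v → d + (w i l + v))
                                                                   (size-reorient b~a D.piece (suc l)) (+-identityʳ (w j l)) ⟨
    size D′ (suc l) + (w i l + (w j l + 0))                   ∎
    where open ≡.≡-Reasoning

  min-Δ : MinDeltaH≡ G G₀ 1
  min-Δ = (S , InH-S , 2 , s≤s z≤n , length-2 , length-3 , λ m 2<m m<3 _ → <⇒≱ 2<m (≤-pred m<3)) ,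
          λ { _ (_ , _ , _ , 1≤d , _) → 1≤d }
    where
    atom′ : ∀ A → Indecomposable a (size A) → IsAtom G G₀ (realise A)
    atom′ = atom (el-injective a<n (λ l → <-≤-trans (s≤s (s≤s z≤n)) (3≤n l)) i≢j aᵢ≢0 aⱼ≢0)
    S : List (AbelianGroup.Carrier G)
    S = concat (map realise (U′ ∷ U′ ∷ []))
    InH-S : InH G G₀ S
    InH-S = InH-++ G (InH-realise U′) (InH-++ G (InH-realise U′) ([] , [] , ≡.refl , AbelianGroup.refl G))
    length-2 : InLengthSet G G₀ S 2
    length-2 = map realise (U′ ∷ U′ ∷ []) , ≡.refl , atom′ U′ U′-indecomposable ∷ atom′ U′ U′-indecomposable ∷ [] ,
               Setoid-↭.↭-refl (AbelianGroup.setoid G)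
      where U′-indecomposable : Indecomposable a (size U′)
            U′-indecomposable = reoriented-indecomposable U.piece U-indecomposable
    length-3 : InLengthSet G G₀ S 3
    length-3 = map realise (D′ ∷ W i ∷ W j ∷ []) , ≡.refl ,
               atom′ D′ (reoriented-indecomposable D.piece D-indecomposable) ∷
               atom′ (W i) (spike-indecomposable i (0<n i) (odd i)) ∷ atom′ (W j) (spike-indecomposable j (0<n j) (odd j)) ∷ [] ,
               realise-↭ (U′ ∷ U′ ∷ []) (D′ ∷ W i ∷ W j ∷ []) sizes-agree

lemma4p13 : ∀ {c ℓ : Level} (G : AbelianGroup c ℓ) → IsFiniteGroup G →
  (k : ℕ) (e : Fin k → AbelianGroup.Carrier G) (n : Fin k → ℕ) →
  Independent G k e →
  (∀ i → HasOrder G (e i) (n i)) →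
  (∀ i → ¬ (2 ∣ n i)) →
  (∀ i → 3 ≤ n i) →
  (a : Fin k → ℕ) → (∀ i → a i < n i) →
  (∃[ i ] ∃[ j ] (i ≢ j) × (a i ≢ 0) × (a j ≢ 0)) →
  let open AbelianGroup G
      e₀ = sumFin G k (λ i → natMul G (a i) (e i))
  in MinDeltaH≡ G (λ g → (g ≈ e₀) ⊎ (∃[ i ] g ≈ e i)) 1
lemma4p13 G _ k e n indep ho odd 3≤n a a<n (i , j , i≢j , aᵢ≢0 , aⱼ≢0) =
  Construction.min-Δ G e n a indep ho odd 3≤n a<n i≢j aᵢ≢0 aⱼ≢0
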